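{- Let $K$ be a number field, $\ell$ a prime number, and $\mathcal G$ a finitely generated torsion-free subgroup of $K^\times$. Let $m$ be a positive integer such that for all $n\in\mathbb Z_{\geqslant0}$ and $x\in K^\times$ with $x^{\ell^n}\in\mathcal G$ we have $x^{\ell^m}\in\mathcal G$. Then no element of a basis (as free $\mathbb Z$-module) of $\mathcal G$ is an $\ell^{m+1}$-st power in $K^\times$. -}

module Defs where

open import Level using (Level; _⊔_) renaming (suc to lsuc)
open import Algebra.Bundles using (CommutativeRing)
open import Algebra.Morphism.Structures using (IsRingHomomorphism)
open import Data.Nat using (ℕ; zero; suc; _≤_)
open import Data.Integer using (ℤ; _⊖_; +_; -[1+_])
open import Data.Fin using (Fin)
open import Data.Product using (Σ; ∃; _×_)
open import Data.Rational using (ℚ; 0ℚ)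
import Data.Rational.Base as ℚB
open import Relation.Binary.PropositionalEquality using (_≡_)
open import Relation.Nullary using (¬_)

module RingOps {c ℓ : Level} (R : CommutativeRing c ℓ) where
  open CommutativeRing R

  pow : Carrier → ℕ → Carrier
  pow x zero    = 1#
  pow x (suc n) = x * pow x n

  sumF : ∀ {n} → (Fin n → Carrier) → Carrier
  sumF {zero}  f = 0#
  sumF {suc n} f = f Fin.zero + sumF (λ i → f (Fin.suc i))
    where import Data.Fin as Fin

  prodF : ∀ {n} → (Fin n → Carrier) → Carrier
  prodF {zero}  f = 1#
  prodF {suc n} f = f Fin.zero * prodF (λ i → f (Fin.suc i))
    where import Data.Fin as Fin

  pos : ℤ → ℕ
  pos (+ n)    = n
  pos -[1+ n ] = 0

  neg : ℤ → ℕ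
  neg (+ n)    = 0
  neg -[1+ n ] = suc n

  -- "g = ∏ᵢ bᵢ^{kᵢ}" in K^×, written without inverses:
  --   g · ∏ᵢ bᵢ^{max(-kᵢ,0)}  =  ∏ᵢ bᵢ^{max(kᵢ,0)}
  -- (equivalent to the usual meaning since all bᵢ are units).
  IsProdPow : ∀ {r} → (Fin r → Carrier) → (Fin r → ℤ) → Carrier → Set ℓ
  IsProdPow b k g = (g * prodF (λ i → pow (b i) (neg (k i)))) ≈ prodF (λ i → pow (b i) (pos (k i)))

record NumberField (c ℓ : Level) : Set (lsuc (c ⊔ ℓ)) where
  field
    cring : CommutativeRing c ℓ
  open CommutativeRing cring
  open RingOps cring
  field
    1≉0      : ¬ (1# ≈ 0#)
    inverse  : ∀ x → ¬ (x ≈ 0#) → ∃ λ y → (x * y) ≈ 1#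
    ι        : ℚ → Carrier
    ι-hom    : IsRingHomomorphism ℚB.+-*-rawRing rawRing ι
    degree   : ℕ
    basis    : Fin degree → Carrier
    spanning : ∀ x → ∃ λ (a : Fin degree → ℚ) → x ≈ sumF (λ i → ι (a i) * basis i)
    independent : ∀ (a : Fin degree → ℚ) → sumF (λ i → ι (a i) * basis i) ≈ 0#
                  → ∀ i → a i ≡ 0ℚ

module _ {c ℓ : Level} (K : NumberField c ℓ) where
  open NumberField K using (cring)
  open CommutativeRing cring
  open RingOps cring

  record Subgroup (p : Level) : Set (c ⊔ ℓ ⊔ lsuc p) where
    field
      _∈G_     : Carrier → Set p
      resp     : ∀ {x y} → x ≈ y → _∈G_ x → _∈G_ y
      nonzero  : ∀ {x} → _∈G_ x → ¬ (x ≈ 0#)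
      one∈     : _∈G_ 1#
      mul∈     : ∀ {x y} → _∈G_ x → _∈G_ y → _∈G_ (x * y)
      inv∈     : ∀ {x y} → _∈G_ x → (x * y) ≈ 1# → _∈G_ y

  module _ {p : Level} (G : Subgroup p) where
    open Subgroup G

    FinitelyGenerated : Set (c ⊔ ℓ ⊔ p)
    FinitelyGenerated =
      Σ ℕ λ r → Σ (Fin r → Carrier) λ gen →
        (∀ i → _∈G_ (gen i)) ×
        (∀ g → _∈G_ g → ∃ λ (k : Fin r → ℤ) → IsProdPow gen k g)

    TorsionFree : Set (c ⊔ ℓ ⊔ p)
    TorsionFree = ∀ g → _∈G_ g → ∀ (k : ℕ) → 1 ≤ k → pow g k ≈ 1# → g ≈ 1#

    -- b is a basis of G as a free ℤ-module (written multiplicatively):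
    -- every element of G is uniquely a product of integer powers of the bᵢ.
    IsBasis : ∀ {r} → (Fin r → Carrier) → Set (c ⊔ ℓ ⊔ p)
    IsBasis {r} b =
      (∀ i → _∈G_ (b i)) ×
      (∀ g → _∈G_ g → ∃ λ (k : Fin r → ℤ) → IsProdPow b k g) ×
      (∀ g (k k′ : Fin r → ℤ) → IsProdPow b k g → IsProdPow b k′ g → ∀ i → k i ≡ k′ i)

-- If bᵢ = y^(ℓ^(m+1)) then y has an ℓ^(m+1)-th power in 𝒢, so z = y^(ℓ^m) ∈ 𝒢 by the
-- choice of m.  Expanding z in the basis, zˡ = bᵢ gives a second expansion of bᵢ, with
-- i-th exponent ℓ·kᵢ; uniqueness of exponents forces ℓ·kᵢ = 1, hence ℓ = 1.
{-# OPTIONS --safe #-}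
module Submission where

open import Defs
open import Level using (Level)
open import Algebra.Bundles using (CommutativeRing)
open import Data.Nat as ℕ using (ℕ; suc; _≤_; _^_)
open import Data.Nat.Primality using (Prime; ¬prime[1])
open import Data.Fin as Fin using (Fin)
open import Data.Product using (∃; _×_; _,_)
open import Relation.Nullary using (¬_)

import Data.Nat.Properties as ℕ
open import Data.Integer as ℤ using (ℤ; +_; -[1+_]; ∣_∣)
import Data.Integer.Properties as ℤ
open import Relation.Binary.PropositionalEquality as ≡ using (_≡_)
import Algebra.Properties.Semiring.Exp as SemiringExp
import Algebra.Properties.CommutativeSemiring.Exp as CommutativeSemiringExp
import Relation.Binary.Reasoning.Setoid as SetoidReasoning

δ : ∀ {r} → Fin r → Fin r → ℤ
δ Fin.zero    Fin.zero    = + 1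
δ Fin.zero    (Fin.suc j) = + 0
δ (Fin.suc i) Fin.zero    = + 0
δ (Fin.suc i) (Fin.suc j) = δ i j

δ-diag : ∀ {r} (i : Fin r) → δ i i ≡ + 1
δ-diag Fin.zero    = ≡.refl
δ-diag (Fin.suc i) = δ-diag i

+m*i≡1⇒m≡1 : ∀ m i → + m ℤ.* i ≡ + 1 → m ≡ 1
+m*i≡1⇒m≡1 m i eq = ℕ.m*n≡1⇒m≡1 m ∣ i ∣ (≡.trans (≡.sym (ℤ.abs-* (+ m) i)) (≡.cong ∣_∣ eq))

+m*-[1+n]≡-+[m*1+n] : ∀ m n → + m ℤ.* -[1+ n ] ≡ ℤ.- + (m ℕ.* suc n)
+m*-[1+n]≡-+[m*1+n] m n = begin
  + m ℤ.* ℤ.- + suc n      ≡⟨ ℤ.neg-distribʳ-* (+ m) (+ suc n) ⟨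
  ℤ.- (+ m ℤ.* + suc n)    ≡⟨ ≡.cong ℤ.-_ (ℤ.pos-* m (suc n)) ⟨
  ℤ.- + (m ℕ.* suc n)      ∎
  where open ≡.≡-Reasoning

module Exponents {c ℓ : Level} (R : CommutativeRing c ℓ) where
  open RingOps R using (pos; neg)
  open ≡.≡-Reasoning

  pos[-+n]≡0 : ∀ n → pos (ℤ.- + n) ≡ 0
  pos[-+n]≡0 ℕ.zero  = ≡.refl
  pos[-+n]≡0 (suc n) = ≡.refl

  neg[-+n]≡n : ∀ n → neg (ℤ.- + n) ≡ n
  neg[-+n]≡n ℕ.zero  = ≡.refl
  neg[-+n]≡n (suc n) = ≡.refl

  pos-+* : ∀ m k → pos (+ m ℤ.* k) ≡ m ℕ.* pos k
  pos-+* m (+ n)    = ≡.cong pos (≡.sym (ℤ.pos-* m n))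
  pos-+* m -[1+ n ] = begin
    pos (+ m ℤ.* -[1+ n ])     ≡⟨ ≡.cong pos (+m*-[1+n]≡-+[m*1+n] m n) ⟩
    pos (ℤ.- + (m ℕ.* suc n))  ≡⟨ pos[-+n]≡0 (m ℕ.* suc n) ⟩
    0                          ≡⟨ ℕ.*-zeroʳ m ⟨
    m ℕ.* 0                    ∎

  neg-+* : ∀ m k → neg (+ m ℤ.* k) ≡ m ℕ.* neg k
  neg-+* m (+ n)    = begin
    neg (+ m ℤ.* + n)          ≡⟨ ≡.cong neg (ℤ.pos-* m n) ⟨
    0                          ≡⟨ ℕ.*-zeroʳ m ⟨
    m ℕ.* 0                    ∎
  neg-+* m -[1+ n ] = begin
    neg (+ m ℤ.* -[1+ n ])     ≡⟨ ≡.cong neg (+m*-[1+n]≡-+[m*1+n] m n) ⟩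
    neg (ℤ.- + (m ℕ.* suc n))  ≡⟨ neg[-+n]≡n (m ℕ.* suc n) ⟩
    m ℕ.* suc n                ∎

module ProdPow {c ℓ : Level} (R : CommutativeRing c ℓ) where
  open CommutativeRing R
  open RingOps R
  open SemiringExp semiring using (^-congˡ; ^-assocʳ) renaming (_^_ to _^ᴿ_)
  open CommutativeSemiringExp commutativeSemiring using (^-distrib-*)
  open SetoidReasoning setoid
  open Exponents R

  pow≡^ : ∀ x n → pow x n ≡ x ^ᴿ n
  pow≡^ x ℕ.zero    = ≡.refl
  pow≡^ x (suc n) = ≡.cong (x *_) (pow≡^ x n)

  pow-cong : ∀ n {x y} → x ≈ y → pow x n ≈ pow y n
  pow-cong n {x} {y} x≈y = begin
    pow x n  ≡⟨ pow≡^ x n ⟩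
    x ^ᴿ n   ≈⟨ ^-congˡ n x≈y ⟩
    y ^ᴿ n   ≡⟨ pow≡^ y n ⟨
    pow y n  ∎

  pow-distrib-* : ∀ x y n → pow (x * y) n ≈ pow x n * pow y n
  pow-distrib-* x y n = begin
    pow (x * y) n         ≡⟨ pow≡^ (x * y) n ⟩
    (x * y) ^ᴿ n          ≈⟨ ^-distrib-* x y n ⟩
    x ^ᴿ n * y ^ᴿ n       ≡⟨ ≡.cong₂ _*_ (pow≡^ x n) (pow≡^ y n) ⟨
    pow x n * pow y n     ∎

  pow-* : ∀ x n a → pow x (n ℕ.* a) ≈ pow (pow x a) n
  pow-* x n a = begin
    pow x (n ℕ.* a)       ≡⟨ ≡.cong (pow x) (ℕ.*-comm n a) ⟩
    pow x (a ℕ.* n)       ≡⟨ pow≡^ x (a ℕ.* n) ⟩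
    x ^ᴿ (a ℕ.* n)        ≈⟨ ^-assocʳ x a n ⟨
    (x ^ᴿ a) ^ᴿ n         ≡⟨ ≡.cong (_^ᴿ n) (pow≡^ x a) ⟨
    (pow x a) ^ᴿ n        ≡⟨ pow≡^ (pow x a) n ⟨
    pow (pow x a) n       ∎

  prodF-cong : ∀ {n} {f g : Fin n → Carrier} → (∀ j → f j ≈ g j) → prodF f ≈ prodF g
  prodF-cong {ℕ.zero} f≈g = refl
  prodF-cong {suc n}  f≈g = *-cong (f≈g Fin.zero) (prodF-cong (λ j → f≈g (Fin.suc j)))

  prodF-1 : ∀ n → prodF {n} (λ _ → 1#) ≈ 1#
  prodF-1 ℕ.zero    = refl
  prodF-1 (suc n) = trans (*-identityˡ _) (prodF-1 n)

  pow-1ˡ : ∀ n → pow 1# n ≈ 1#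
  pow-1ˡ ℕ.zero  = refl
  pow-1ˡ (suc n) = trans (*-identityˡ _) (pow-1ˡ n)

  pow-prodF : ∀ {r} (f : Fin r → Carrier) n → pow (prodF f) n ≈ prodF (λ j → pow (f j) n)
  pow-prodF {ℕ.zero} f n = pow-1ˡ n
  pow-prodF {suc r} f n =
    trans (pow-distrib-* _ _ n) (*-congˡ (pow-prodF (λ j → f (Fin.suc j)) n))

  module _ {r} (b : Fin r → Carrier) where

    isProdPow-resp : ∀ k {g h} → g ≈ h → IsProdPow b k g → IsProdPow b k h
    isProdPow-resp k g≈h g=∏ = trans (*-congʳ (sym g≈h)) g=∏

    prodF-pow-homo : ∀ n (k : Fin r → ℤ) (part : ℤ → ℕ) → (∀ i → part (+ n ℤ.* i) ≡ n ℕ.* part i) →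
      prodF (λ j → pow (b j) (part (+ n ℤ.* k j))) ≈ pow (prodF (λ j → pow (b j) (part (k j)))) n
    prodF-pow-homo n k part homo = begin
      prodF (λ j → pow (b j) (part (+ n ℤ.* k j)))  ≈⟨ prodF-cong (λ j → reflexive (≡.cong (pow (b j)) (homo (k j)))) ⟩
      prodF (λ j → pow (b j) (n ℕ.* part (k j)))    ≈⟨ prodF-cong (λ j → pow-* (b j) n (part (k j))) ⟩
      prodF (λ j → pow (pow (b j) (part (k j))) n)  ≈⟨ pow-prodF (λ j → pow (b j) (part (k j))) n ⟨
      pow (prodF (λ j → pow (b j) (part (k j)))) n  ∎

    isProdPow-pow : ∀ n k {g} → IsProdPow b k g → IsProdPow b (λ j → + n ℤ.* k j) (pow g n)
    isProdPow-pow n k {g} g=∏ = begin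
      pow g n * prodF (λ j → pow (b j) (neg (+ n ℤ.* k j)))  ≈⟨ *-congˡ (prodF-pow-homo n k neg (neg-+* n)) ⟩
      pow g n * pow (prodF (λ j → pow (b j) (neg (k j)))) n  ≈⟨ pow-distrib-* g _ n ⟨
      pow (g * prodF (λ j → pow (b j) (neg (k j)))) n        ≈⟨ pow-cong n g=∏ ⟩
      pow (prodF (λ j → pow (b j) (pos (k j)))) n            ≈⟨ prodF-pow-homo n k pos (pos-+* n) ⟨
      prodF (λ j → pow (b j) (pos (+ n ℤ.* k j)))            ∎

  isProdPow-δ : ∀ {r} (b : Fin r → Carrier) i → IsProdPow b (δ i) (b i)
  isProdPow-δ {suc r} b Fin.zero = begin
    b Fin.zero * (1# * prodF {r} (λ _ → 1#))  ≈⟨ *-congˡ (*-identityˡ _) ⟩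
    b Fin.zero * prodF {r} (λ _ → 1#)         ≈⟨ *-congʳ (*-identityʳ _) ⟨
    (b Fin.zero * 1#) * prodF {r} (λ _ → 1#)  ∎
  isProdPow-δ {suc r} b (Fin.suc i) =
    trans (*-congˡ (*-identityˡ _)) (trans (isProdPow-δ (λ j → b (Fin.suc j)) i) (sym (*-identityˡ _)))

module _ {c ℓ p : Level} (K : NumberField c ℓ) (G : Subgroup K p) where
  open NumberField K using (cring)
  open CommutativeRing cring
  open RingOps cring
  open Subgroup G
  open ProdPow cring

  pow≈basis⇒≡1 : ∀ {r} {b : Fin r → Carrier} → IsBasis K G b →
    ∀ i n {z} → _∈G_ z → pow z n ≈ b i → n ≡ 1
  pow≈basis⇒≡1 {b = b} (_ , expand , unique) i n {z} z∈ zⁿ≈bᵢ with expand z z∈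
  ... | k , z=∏ = +m*i≡1⇒m≡1 n (k i) (≡.trans (unique (b i) nk (δ i) bᵢ=∏ (isProdPow-δ b i) i) (δ-diag i))
    where
    nk : Fin _ → ℤ
    nk j = + n ℤ.* k j

    bᵢ=∏ : IsProdPow b nk (b i)
    bᵢ=∏ = isProdPow-resp b nk zⁿ≈bᵢ (isProdPow-pow b n k z=∏)

corollary3p2 : ∀ {c ℓ p : Level} (K : NumberField c ℓ) (ℓ′ : ℕ) → Prime ℓ′ →
    (G : Subgroup K p) → FinitelyGenerated K G → TorsionFree K G →
    (m : ℕ) → 1 ≤ m →
    (∀ (n : ℕ) (x : CommutativeRing.Carrier (NumberField.cring K)) →
      ¬ CommutativeRing._≈_ (NumberField.cring K) x (CommutativeRing.0# (NumberField.cring K)) →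
      Subgroup._∈G_ G (RingOps.pow (NumberField.cring K) x (ℓ′ ^ n)) →
      Subgroup._∈G_ G (RingOps.pow (NumberField.cring K) x (ℓ′ ^ m))) →
    ∀ (r : ℕ) (b : Fin r → CommutativeRing.Carrier (NumberField.cring K)) → IsBasis K G b →
    ∀ (i : Fin r) → ¬ (∃ λ y →
      ¬ CommutativeRing._≈_ (NumberField.cring K) y (CommutativeRing.0# (NumberField.cring K)) ×
      CommutativeRing._≈_ (NumberField.cring K) (RingOps.pow (NumberField.cring K) y (ℓ′ ^ suc m)) (b i))
corollary3p2 K ℓ′ ℓ′-prime G _ _ m _ saturated r b basis@(b∈ , _) i (y , y≉0 , y^ℓ^[1+m]≈bᵢ) =
  ¬prime[1] (≡.subst Prime (pow≈basis⇒≡1 K G basis i ℓ′ z∈ zˡ≈bᵢ) ℓ′-prime)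
  where
  open NumberField K using (cring)
  open CommutativeRing cring
  open RingOps cring
  open Subgroup G
  open ProdPow cring

  z : Carrier
  z = pow y (ℓ′ ^ m)

  zˡ≈bᵢ : pow z ℓ′ ≈ b i
  zˡ≈bᵢ = trans (sym (pow-* y ℓ′ (ℓ′ ^ m))) y^ℓ^[1+m]≈bᵢ

  z∈ : _∈G_ z
  z∈ = saturated (suc m) y y≉0 (resp (sym y^ℓ^[1+m]≈bᵢ) (b∈ i))
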